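{- Let $\mathsf{T}:\mathsf{Krip}\to\mathsf{Pos}$ be a functor, $\Lambda$ a set of predicate liftings for $\mathsf{T}$, $\phi\in\mathcal{L}(\Lambda)$, and $(\mathcal{X}_k)_{k\in K}$ a family of $(\mathsf{i},\mathsf{T})$-dialgebras indexed by a set $K$ with $\mathcal{X}_k\Vdash\phi$ for all $k\in K$. Then $\coprod_{k\in K}\mathcal{X}_k\Vdash\phi$.
   Context: $\mathsf{Krip}$: posets and p-morphisms (order-preserving $f$ such that $f(x)\le' y'$ implies some $y\ge x$ has $f(y)=y'$); $\mathsf{Pos}$: posets and order-preserving maps; $\mathsf{i}$ the inclusion. An $(\mathsf{i},\mathsf{T})$-dialgebra is $(X,\le,\gamma)$ with $\gamma:(X,\le)\to\mathsf{T}(X,\le)$ order-preserving; morphisms are p-morphisms $f$ with $\mathsf{T}f\circ\gamma=\gamma'\circ f$. $\coprod_k\mathcal{X}_k$ is the coproduct in this category: the disjoint union poset with injections $\kappa_k$ and structure map $\gamma(x)=\mathsf{T}\kappa_k(\gamma_k(x))$ for $x\in X_k$. Predicate liftings: families $\lambda_{(X,\le)}:\mathrm{Up}(X,\le)^n\to\mathrm{Up}(\mathsf{T}(X,\le))$ (upsets) natural in the sense $\lambda(f^{ -1}a_1,\dots,f^{ -1}a_n)=(\mathsf{T}f)^{ -1}\lambda(a_1,\dots,a_n)$ for p-morphisms $f$. $\mathcal{L}(\Lambda)$: intuitionistic propositional formulas over a countably infinite set of letters closed under $\heartsuit^\lambda(\phi_1,\dots,\phi_n)$. Given a valuation $V$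 into upsets, truth is intuitionistic for connectives ($x\Vdash\phi\to\psi$ iff all $y\ge x$ satisfying $\phi$ satisfy $\psi$) and $x\Vdash\heartsuit^\lambda(\phi_1,\dots)$ iff $\gamma(x)\in\lambda_{(X,\le)}([\![\phi_1]\!],\dots)$. $\mathcal{X}\Vdash\phi$ means $\phi$ holds at every state under every valuation. -}

module Defs where

open import Data.Nat using (ℕ)
open import Data.Fin using (Fin)
open import Data.Product using (Σ; _,_; proj₁; proj₂; _×_)
open import Data.Sum using (_⊎_; inj₁; inj₂)
open import Data.Unit using (⊤; tt)
open import Data.Empty using (⊥)
open import Relation.Binary.PropositionalEquality using (_≡_; refl; cong)

infix 2 _⇔_
_⇔_ : Set → Set → Set
A ⇔ B = (A → B) × (B → A)

record Pos : Set₁ where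
  field
    Carrier : Set
    _≤_     : Carrier → Carrier → Set
    ≤-refl  : ∀ {x} → x ≤ x
    ≤-trans : ∀ {x y z} → x ≤ y → y ≤ z → x ≤ z
    ≤-antisym : ∀ {x y} → x ≤ y → y ≤ x → x ≡ y
open Pos public

record Mono (X Y : Pos) : Set where
  field
    fun  : Carrier X → Carrier Y
    mono : ∀ {x y} → _≤_ X x y → _≤_ Y (fun x) (fun y)
open Mono public

-- p-morphisms (morphisms of Krip)
record PMor (X Y : Pos) : Set where
  field
    pfun  : Carrier X → Carrier Y
    pmono : ∀ {x y} → _≤_ X x y → _≤_ Y (pfun x) (pfun y)
    back  : ∀ {x y'} → _≤_ Y (pfun x) y' →
            Σ (Carrier X) (λ y → _≤_ X x y × pfun y ≡ y')
open PMor public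

idP : (X : Pos) → PMor X X
idP X = record { pfun = λ x → x ; pmono = λ p → p
               ; back = λ {x} {y'} p → y' , p , refl }

_∘P_ : {X Y Z : Pos} → PMor Y Z → PMor X Y → PMor X Z
_∘P_ {X} {Y} {Z} g f = record
  { pfun = λ x → pfun g (pfun f x)
  ; pmono = λ p → pmono g (pmono f p)
  ; back = bk }
  where
  bk : ∀ {x z'} → _≤_ Z (pfun g (pfun f x)) z' →
       Σ (Carrier X) (λ y → _≤_ X x y × pfun g (pfun f y) ≡ z')
  bk p with back g p
  ... | y₁ , q , refl with back f q
  ... | y₂ , r , refl = y₂ , r , refl

record Functor : Set₁ where
  field
    T₀ : Pos → Pos
    T₁ : {X Y : Pos} → PMor X Y → Mono (T₀ X) (T₀ Y)
    -- morphisms are determined by their underlying functions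
    T-cong : {X Y : Pos} (f g : PMor X Y) → (∀ x → pfun f x ≡ pfun g x) →
             ∀ t → fun (T₁ f) t ≡ fun (T₁ g) t
    T-id   : (X : Pos) → ∀ t → fun (T₁ (idP X)) t ≡ t
    T-comp : {X Y Z : Pos} (g : PMor Y Z) (f : PMor X Y) →
             ∀ t → fun (T₁ (g ∘P f)) t ≡ fun (T₁ g) (fun (T₁ f) t)
open Functor public

record Up (X : Pos) : Set₁ where
  field
    mem   : Carrier X → Set
    upcl  : ∀ {x y} → _≤_ X x y → mem x → mem y
open Up public

preimage : {X Y : Pos} → PMor X Y → Up Y → Up X
preimage f a = record { mem = λ x → mem a (pfun f x)
                      ; upcl = λ p m → upcl a (pmono f p) m }

record PredLifting (T : Functor) (n : ℕ) : Set₁ where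
  field
    lift : (X : Pos) → (Fin n → Up X) → Up (T₀ T X)
    -- upsets are sets: extensionally equal arguments give equal results
    lift-cong : (X : Pos) (as bs : Fin n → Up X) →
                (∀ i x → mem (as i) x ⇔ mem (bs i) x) →
                ∀ t → mem (lift X as) t ⇔ mem (lift X bs) t
    natural : {X Y : Pos} (f : PMor X Y) (as : Fin n → Up Y) →
              ∀ t → mem (lift X (λ i → preimage f (as i))) t
                    ⇔ mem (lift Y as) (fun (T₁ T f) t)
open PredLifting public

record LiftingSet (T : Functor) : Set₁ where
  field
    Idx : Set
    ar  : Idx → ℕ
    λ[_] : (l : Idx) → PredLifting T (ar l)
open LiftingSet public

data Form {T : Functor} (Λ : LiftingSet T) : Set where
  var  : ℕ → Form Λ
  ⊤'   : Form Λ
  ⊥'   : Form Λ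
  _∧'_ : Form Λ → Form Λ → Form Λ
  _∨'_ : Form Λ → Form Λ → Form Λ
  _⇒'_ : Form Λ → Form Λ → Form Λ
  ♡    : (l : Idx Λ) → (Fin (ar Λ l) → Form Λ) → Form Λ

record Dialg (T : Functor) : Set₁ where
  field
    pos : Pos
    γ   : Mono pos (T₀ T pos)
open Dialg public

Valuation : (X : Pos) → Set₁
Valuation X = ℕ → Up X

module Semantics {T : Functor} (Λ : LiftingSet T) (𝒳 : Dialg T) (V : Valuation (pos 𝒳)) where
  X = pos 𝒳

  ⟦_⟧ : Form Λ → Up X
  ⟦ var p ⟧ = V p
  ⟦ ⊤' ⟧ = record { mem = λ _ → ⊤ ; upcl = λ _ _ → tt }
  ⟦ ⊥' ⟧ = record { mem = λ _ → ⊥ ; upcl = λ _ () }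
  ⟦ φ ∧' ψ ⟧ = record { mem = λ x → mem ⟦ φ ⟧ x × mem ⟦ ψ ⟧ x
                      ; upcl = λ p m → upcl ⟦ φ ⟧ p (proj₁ m) , upcl ⟦ ψ ⟧ p (proj₂ m) }
  ⟦ φ ∨' ψ ⟧ = record { mem = λ x → mem ⟦ φ ⟧ x ⊎ mem ⟦ ψ ⟧ x
                      ; upcl = λ { p (inj₁ m) → inj₁ (upcl ⟦ φ ⟧ p m)
                                 ; p (inj₂ m) → inj₂ (upcl ⟦ ψ ⟧ p m) } }
  ⟦ φ ⇒' ψ ⟧ = record { mem = λ x → ∀ y → _≤_ X x y → mem ⟦ φ ⟧ y → mem ⟦ ψ ⟧ y
                      ; upcl = λ p m z q → m z (≤-trans X p q) }
  ⟦ ♡ l φs ⟧ = record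
    { mem = λ x → mem (lift (λ[ Λ ] l) X (λ i → ⟦ φs i ⟧)) (fun (γ 𝒳) x)
    ; upcl = λ p m → upcl (lift (λ[ Λ ] l) X (λ i → ⟦ φs i ⟧)) (mono (γ 𝒳) p) m }

Forces : {T : Functor} (Λ : LiftingSet T) (𝒳 : Dialg T) → Valuation (pos 𝒳) →
         Carrier (pos 𝒳) → Form Λ → Set
Forces Λ 𝒳 V x φ = mem (Semantics.⟦_⟧ Λ 𝒳 V φ) x

Valid : {T : Functor} (Λ : LiftingSet T) → Dialg T → Form Λ → Set₁
Valid Λ 𝒳 φ = (V : Valuation (pos 𝒳)) (x : Carrier (pos 𝒳)) → Forces Λ 𝒳 V x φ

module _ {K : Set} (Xs : K → Pos) where
  data _≤∐_ : Σ K (λ k → Carrier (Xs k)) → Σ K (λ k → Carrier (Xs k)) → Set where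
    inj≤ : ∀ {k x y} → _≤_ (Xs k) x y → (k , x) ≤∐ (k , y)

  ∐Pos : Pos
  ∐Pos = record
    { Carrier = Σ K (λ k → Carrier (Xs k))
    ; _≤_ = _≤∐_
    ; ≤-refl = λ { {k , x} → inj≤ (≤-refl (Xs k)) }
    ; ≤-trans = λ { {k , _} (inj≤ p) (inj≤ q) → inj≤ (≤-trans (Xs k) p q) }
    ; ≤-antisym = λ { {k , _} (inj≤ p) (inj≤ q) → cong (k ,_) (≤-antisym (Xs k) p q) } }

  κ : (k : K) → PMor (Xs k) ∐Pos
  κ k = record
    { pfun = λ x → k , x
    ; pmono = inj≤
    ; back = λ { (inj≤ {y = y} p) → y , p , refl } }

∐ : (T : Functor) (K : Set) → (K → Dialg T) → Dialg T
∐ T K 𝒳s = record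
  { pos = ∐Pos (λ k → pos (𝒳s k))
  ; γ = record
    { fun = λ { (k , x) → fun (T₁ T (κ (λ k → pos (𝒳s k)) k)) (fun (γ (𝒳s k)) x) }
    ; mono = λ { (inj≤ {k} p) → mono (T₁ T (κ (λ k → pos (𝒳s k)) k)) (mono (γ (𝒳s k)) p) } } }

-- Truth of formulas is invariant under dialgebra morphisms: the backward
-- condition of p-morphisms handles implication, naturality of the liftings
-- handles the modalities.  The coproduct injections are dialgebra morphisms
-- whose images cover the coproduct, so validity on every summand transfers.
module Submission where

open import Defs
open import Data.Product using (Σ; _,_; proj₁; proj₂)
open import Data.Sum using (inj₁; inj₂)
open import Relation.Binary.PropositionalEquality using (_≡_; refl; subst; sym)

⇔-refl : ∀ {A} → A ⇔ A
⇔-refl = (λ a → a) , (λ a → a)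

⇔-trans : ∀ {A B C} → A ⇔ B → B ⇔ C → A ⇔ C
⇔-trans (f , g) (h , k) = (λ a → h (f a)) , (λ c → g (k c))

record DialgHom {T : Functor} (𝒳 𝒴 : Dialg T) : Set where
  field
    hom      : PMor (pos 𝒳) (pos 𝒴)
    commutes : ∀ x → fun (T₁ T hom) (fun (γ 𝒳) x) ≡ fun (γ 𝒴) (pfun hom x)
open DialgHom

preimageᵛ : {X Y : Pos} → PMor X Y → Valuation Y → Valuation X
preimageᵛ f V p = preimage f (V p)

module _ {T : Functor} (Λ : LiftingSet T) {𝒳 𝒴 : Dialg T}
         (f : DialgHom 𝒳 𝒴) (V : Valuation (pos 𝒴)) where

  private
    open Semantics Λ 𝒳 (preimageᵛ (hom f) V) using () renaming (⟦_⟧ to ⟦_⟧ˣ)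
    open Semantics Λ 𝒴 V using () renaming (⟦_⟧ to ⟦_⟧ʸ)

  forces-hom : ∀ φ x → Forces Λ 𝒳 (preimageᵛ (hom f) V) x φ ⇔ Forces Λ 𝒴 V (pfun (hom f) x) φ
  forces-hom (var p)  x = ⇔-refl
  forces-hom ⊤'       x = ⇔-refl
  forces-hom ⊥'       x = ⇔-refl
  forces-hom (φ ∧' ψ) x =
    (λ { (a , b) → proj₁ (forces-hom φ x) a , proj₁ (forces-hom ψ x) b }) ,
    (λ { (a , b) → proj₂ (forces-hom φ x) a , proj₂ (forces-hom ψ x) b })
  forces-hom (φ ∨' ψ) x =
    (λ { (inj₁ a) → inj₁ (proj₁ (forces-hom φ x) a) ; (inj₂ b) → inj₂ (proj₁ (forces-hom ψ x) b) }) ,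
    (λ { (inj₁ a) → inj₁ (proj₂ (forces-hom φ x) a) ; (inj₂ b) → inj₂ (proj₂ (forces-hom ψ x) b) })
  forces-hom (φ ⇒' ψ) x = to , from
    where
    to : Forces Λ 𝒳 (preimageᵛ (hom f) V) x (φ ⇒' ψ) → Forces Λ 𝒴 V (pfun (hom f) x) (φ ⇒' ψ)
    to m y' fx≤y' a with back (hom f) fx≤y'
    ... | y , x≤y , refl = proj₁ (forces-hom ψ y) (m y x≤y (proj₂ (forces-hom φ y) a))
    from : Forces Λ 𝒴 V (pfun (hom f) x) (φ ⇒' ψ) → Forces Λ 𝒳 (preimageᵛ (hom f) V) x (φ ⇒' ψ)
    from m y x≤y a = proj₂ (forces-hom ψ y) (m _ (pmono (hom f) x≤y) (proj₁ (forces-hom φ y) a))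
  forces-hom (♡ l φs) x =
    ⇔-trans (lift-cong L (pos 𝒳) (λ i → ⟦ φs i ⟧ˣ) (λ i → preimage (hom f) ⟦ φs i ⟧ʸ)
                       (λ i y → forces-hom (φs i) y) (fun (γ 𝒳) x))
    (⇔-trans (natural L (hom f) (λ i → ⟦ φs i ⟧ʸ) (fun (γ 𝒳) x))
             (subst inLift (commutes f x) , subst inLift (sym (commutes f x))))
    where
    L : PredLifting T (ar Λ l)
    L = λ[ Λ ] l
    inLift : Carrier (T₀ T (pos 𝒴)) → Set
    inLift = mem (lift L (pos 𝒴) (λ i → ⟦ φs i ⟧ʸ))

valid-cover : {T : Functor} (Λ : LiftingSet T) (φ : Form Λ) {K : Set}
  {𝒳s : K → Dialg T} {𝒴 : Dialg T} (fs : (k : K) → DialgHom (𝒳s k) 𝒴) →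
  (∀ y → Σ K λ k → Σ (Carrier (pos (𝒳s k))) λ x → pfun (hom (fs k)) x ≡ y) →
  ((k : K) → Valid Λ (𝒳s k) φ) → Valid Λ 𝒴 φ
valid-cover Λ φ fs cover valid V y with cover y
... | k , x , refl = proj₁ (forces-hom Λ (fs k) V φ x) (valid k _ x)

∐-injection : (T : Functor) (K : Set) (𝒳s : K → Dialg T) (k : K) → DialgHom (𝒳s k) (∐ T K 𝒳s)
∐-injection T K 𝒳s k = record { hom = κ (λ k → pos (𝒳s k)) k ; commutes = λ _ → refl }

proposition3p11 : (T : Functor) (Λ : LiftingSet T) (φ : Form Λ)
    (K : Set) (𝒳s : K → Dialg T) →
    ((k : K) → Valid Λ (𝒳s k) φ) →
    Valid Λ (∐ T K 𝒳s) φ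
proposition3p11 T Λ φ K 𝒳s =
  valid-cover Λ φ (∐-injection T K 𝒳s) (λ { (k , x) → k , x , refl })
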